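{- Let $n\ge3$ and $1\le i,k\le n-1$. Then $\mathrm{inv}(\mathcal J_{i,k})=\{i\}\times\{i+1,\dots,i+k\}$ if $i\le n-k$, and $\mathrm{inv}(\mathcal J_{i,k})=\{n-k,\dots,i\}\times\{i+1,\dots,n\}$ if $i>n-k$.
   Context: A tube of a graph on $[n]$ is a nonempty vertex set inducing a connected subgraph; tubes $X,Y$ are compatible if $X\subseteq Y$, $Y\subseteq X$, or $X\cup Y$ is not a tube; a maximal tubing is an inclusion-maximal set of pairwise compatible tubes. For a maximal tubing $\mathcal T$ and $x\in[n]$, $\mathcal T_\downarrow(x)$ is the smallest tube of $\mathcal T$ containing $x$. The $G$-tree of $\mathcal T$ is the order $x\le_{\mathcal T}y$ iff $x\in\mathcal T_\downarrow(y)$; a maximal tubing is determined by its $G$-tree. $\mathrm{inv}(\mathcal T)=\{(a,b):a<b,\ b<_{\mathcal T}a\}$. $C_n$ is the cycle with edges $\{i,i+1\}$ and $\{n,1\}$. For $1\le i,k\le n-1$, $\mathcal J_{i,k}$ is the maximal tubing of $C_n$ whose $G$-tree is the poset $j_{i,k}$ on $[n]$ with cover relations: if $1\le k\le n-i-1$: the chain $i\lessdot i+k+1\lessdot\cdots\lessdot n$, the chain $i+1\lessdot\cdots\lessdot i+k\lessdot i$, and the chain $1\lessdot\cdots\lessdot i-1\lessdot i$ (omitted if $i=1$); if $n-i\le k\le n-1$: the chain $n\lessdot n-k\lessdot n-k+1\lessdot\cdots\lessdot i$, the chain $i+1\lessdot\cdots\lessdot n-1\lessdot n$, and the chain $1\lessdot\cdots\lessdot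 n-k-1\lessdot n$ (omitted if $k=n-1$). -}

module Defs where

open import Data.Nat using (ℕ; zero; suc; _+_; _∸_; _≤_; _<_)
open import Data.Product using (_×_; ∃-syntax)
open import Relation.Binary.PropositionalEquality using (_≡_; _≢_)
open import Relation.Binary.Construct.Closure.ReflexiveTransitive using (Star)

-- Vertices of C_n are the naturals 1..n.

data Cover (n i k : ℕ) : ℕ → ℕ → Set where
  -- case 1 ≤ k ≤ n-i-1, i.e. i + k + 1 ≤ n
  -- chain i ⋖ i+k+1 ⋖ ⋯ ⋖ n
  c1a : i + k + 1 ≤ n → Cover n i k i (i + k + 1)
  c1b : ∀ m → i + k + 1 ≤ n → i + k + 1 ≤ m → m < n → Cover n i k m (suc m)
  c1c : ∀ m → i + k + 1 ≤ n → i + 1 ≤ m → m < i + k → Cover n i k m (suc m)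
  c1d : i + k + 1 ≤ n → Cover n i k (i + k) i
  c1e : ∀ m → i + k + 1 ≤ n → 1 ≤ m → m < i → Cover n i k m (suc m)
  -- case n-i ≤ k ≤ n-1, i.e. n ≤ i + k
  -- chain n ⋖ n-k ⋖ n-k+1 ⋖ ⋯ ⋖ i
  c2a : n ≤ i + k → Cover n i k n (n ∸ k)
  c2b : ∀ m → n ≤ i + k → n ∸ k ≤ m → m < i → Cover n i k m (suc m)
  c2c : ∀ m → n ≤ i + k → i + 1 ≤ m → m < n → Cover n i k m (suc m)
  c2d : ∀ m → n ≤ i + k → 1 ≤ m → suc m < n ∸ k → Cover n i k m (suc m)
  c2e : n ≤ i + k → 1 ≤ n ∸ k ∸ 1 → Cover n i k (n ∸ k ∸ 1) n

j≤ : (n i k : ℕ) → ℕ → ℕ → Set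
j≤ n i k = Star (Cover n i k)

InRange : ℕ → ℕ → Set
InRange n x = 1 ≤ x × x ≤ n

-- The maximal tubing J_{i,k} (the tubing whose G-tree is j_{i,k}): its tubes are
-- the principal down-sets of j_{i,k}; the tube indexed by y ∈ [n] is tubeJ n i k y.
tubeJ : (n i k : ℕ) → ℕ → (ℕ → Set)
tubeJ n i k y x = j≤ n i k x y

-- G-tree order of J_{i,k}: x ≤_J y iff x ∈ J↓(y), the smallest tube of J containing y,
-- i.e. x belongs to every tube of J that contains y (tubes containing y are nested).
_≤J[_,_,_]_ : ℕ → ℕ → ℕ → ℕ → ℕ → Set
x ≤J[ n , i , k ] y = ∀ z → InRange n z → tubeJ n i k z y → tubeJ n i k z x

Inv : (n i k : ℕ) → ℕ → ℕ → Set
Inv n i k a b = InRange n a × InRange n b × a < b × (b ≤J[ n , i , k ] a) × b ≢ a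

-- Both regimes of j_{i,k} are built from covers m ⋖ m+1 plus one upward and one downward
-- jump: i ⋖ i+k+1 and i+k ⋖ i when i+k < n, and n-k-1 ⋖ n and n ⋖ n-k when n ≤ i+k. An
-- inversion (a, b) is a path upwards from b to the smaller a, so it must take the downward
-- jump. Following a path from b inside a suitable up-closed set shows that this confines a
-- to {i} resp. [n-k, i] and b to the chain leading into the jump; conversely, these chains
-- followed by the jump are the required paths. At i+k = n the second regime has
-- [n-k, i] = {i}, which is why the theorem splits at i ≤ n-k rather than at i+k < n.
module Submission where

open import Defs
open import Data.Nat using (ℕ; suc; _+_; _∸_; _≤_; _<_; _≤′_; ≤′-refl; ≤′-step; _≤?_; z≤n; s≤s; z<s)
open import Data.Nat.Properties
open import Data.Product using (_×_; _,_; proj₁)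
open import Data.Sum using (_⊎_; inj₁; inj₂; [_,_]′; map₁)
open import Data.Empty using (⊥)
open import Function using (id; _∘_)
open import Function.Bundles using (_⇔_; mk⇔)
open import Function.Properties.Equivalence using () renaming (trans to ⇔-trans)
open import Relation.Nullary using (yes; no; contradiction)
open import Relation.Binary.Core using (Rel)
open import Relation.Binary.Definitions using (_Respects_)
open import Relation.Binary.PropositionalEquality using (_≡_; refl; subst)
open import Relation.Binary.Construct.Closure.ReflexiveTransitive using (Star; ε; _◅_; _◅◅_; fold)

respects-Star : ∀ {a ℓ p} {A : Set a} {R : Rel A ℓ} {P : A → Set p} →
  P Respects R → P Respects Star R
respects-Star {P = P} resp = fold (λ x y → P x → P y) (λ r k → k ∘ resp r) id

ascending-path : ∀ {ℓ} {R : Rel ℕ ℓ} {lo hi} → (∀ {m} → lo ≤ m → m < hi → R m (suc m)) →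
  ∀ {x} → lo ≤ x → x ≤ hi → Star R x hi
ascending-path {R = R} {lo} step {x} lo≤x x≤hi = go step (≤⇒≤′ x≤hi)
  where
  go : ∀ {hi} → (∀ {m} → lo ≤ m → m < hi → R m (suc m)) → x ≤′ hi → Star R x hi
  go step ≤′-refl = ε
  go step (≤′-step x≤′h) =
    go (λ lo≤m m<h → step lo≤m (m<n⇒m<1+n m<h)) x≤′h
    ◅◅ step (≤-trans lo≤x (≤′⇒≤ x≤′h)) ≤-refl ◅ ε

m+1≤n⇒m<n : ∀ {m n} → m + 1 ≤ n → m < n
m+1≤n⇒m<n {m} {n} = subst (_≤ n) (+-comm m 1)

m<n⇒m+1≤n : ∀ {m n} → m < n → m + 1 ≤ n
m<n⇒m+1≤n {m} {n} = subst (_≤ n) (+-comm 1 m)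

m≤n∸1⇒m<n : ∀ {m n} → 1 ≤ n → m ≤ n ∸ 1 → m < n
m≤n∸1⇒m<n {n = suc n} _ = s≤s

module _ {n i k : ℕ} where

  Inv⇒j≤ : ∀ {a b} → Inv n i k a b → j≤ n i k b a
  Inv⇒j≤ (a∈[n] , _ , _ , b≤Ja , _) = b≤Ja _ a∈[n] ε

  j≤⇒Inv : ∀ {a b} → InRange n a → InRange n b → a < b → j≤ n i k b a → Inv n i k a b
  j≤⇒Inv a∈[n] b∈[n] a<b b≤a = a∈[n] , b∈[n] , a<b , (λ _ _ a≤z → b≤a ◅◅ a≤z) , >⇒≢ a<b

  short-or-long : i + k + 1 ≤ n ⊎ n ≤ i + k
  short-or-long = map₁ m<n⇒m+1≤n (<-≤-connex (i + k) n)

  ¬short×long : i + k + 1 ≤ n → n ≤ i + k → ⊥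
  ¬short×long short long = <⇒≱ (m+1≤n⇒m<n short) long

  UpShort : ℕ → ℕ → Set
  UpShort b x = b ≤ x ⊎ (x ≡ i × b ≤ i + k)

  upShort-respects : i + k + 1 ≤ n → ∀ b → UpShort b Respects Cover n i k
  upShort-respects _ b (c1a _) (inj₁ b≤i) = inj₁ (≤-trans b≤i (≤-trans (m≤m+n i k) (m≤m+n _ 1)))
  upShort-respects _ b (c1a _) (inj₂ (_ , b≤i+k)) = inj₁ (≤-trans b≤i+k (m≤m+n _ 1))
  upShort-respects _ b (c1b m _ _ _) (inj₁ b≤m) = inj₁ (m≤n⇒m≤1+n b≤m)
  upShort-respects _ b (c1b _ _ i+k+1≤i _) (inj₂ (refl , _)) = contradiction (m+1≤n⇒m<n i+k+1≤i) (m+n≮m i k)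
  upShort-respects _ b (c1c m _ _ _) (inj₁ b≤m) = inj₁ (m≤n⇒m≤1+n b≤m)
  upShort-respects _ b (c1c _ _ i+1≤i _) (inj₂ (refl , _)) = contradiction (m+1≤n⇒m<n i+1≤i) (<-irrefl refl)
  upShort-respects _ b (c1d _) (inj₁ b≤i+k) = inj₂ (refl , b≤i+k)
  upShort-respects _ b (c1d _) (inj₂ (_ , b≤i+k)) = inj₂ (refl , b≤i+k)
  upShort-respects _ b (c1e m _ _ _) (inj₁ b≤m) = inj₁ (m≤n⇒m≤1+n b≤m)
  upShort-respects _ b (c1e _ _ _ i<i) (inj₂ (refl , _)) = contradiction i<i (<-irrefl refl)
  upShort-respects short b (c2a long) = contradiction long (¬short×long short)
  upShort-respects short b (c2b _ long _ _) = contradiction long (¬short×long short)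
  upShort-respects short b (c2c _ long _ _) = contradiction long (¬short×long short)
  upShort-respects short b (c2d _ long _ _) = contradiction long (¬short×long short)
  upShort-respects short b (c2e long _) = contradiction long (¬short×long short)

  UpLongLow : ℕ → ℕ → Set
  UpLongLow b x = b ≤ x × (n ∸ k < b → x ≤ i)

  upLongLow-respects : n ≤ i + k → i < n → ∀ {b} → b ≤ n → UpLongLow b Respects Cover n i k
  upLongLow-respects _ i<n {b} _ (c2a _) (_ , n≤i) with b ≤? n ∸ k
  ... | yes b≤n-k = b≤n-k , λ n-k<b → contradiction b≤n-k (<⇒≱ n-k<b)
  ... | no b≰n-k = contradiction (n≤i (≰⇒> b≰n-k)) (<⇒≱ i<n)
  upLongLow-respects _ _ _ (c2b _ _ _ m<i) (b≤m , _) = m≤n⇒m≤1+n b≤m , λ _ → m<i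
  upLongLow-respects _ _ _ (c2c _ _ i+1≤m _) (b≤m , m≤i) =
    m≤n⇒m≤1+n b≤m , λ n-k<b → contradiction (m≤i n-k<b) (<⇒≱ (m+1≤n⇒m<n i+1≤m))
  upLongLow-respects _ _ _ (c2d _ _ _ m+1<n-k) (b≤m , _) =
    m≤n⇒m≤1+n b≤m , λ n-k<b → contradiction (≤-trans b≤m (<⇒≤ (<⇒≤ m+1<n-k))) (<⇒≱ n-k<b)
  upLongLow-respects _ _ b≤n (c2e _ _) (b≤n-k-1 , _) =
    b≤n , λ n-k<b → contradiction (≤-trans b≤n-k-1 (m∸n≤m (n ∸ k) 1)) (<⇒≱ n-k<b)
  upLongLow-respects long _ _ (c1a short) = contradiction long (¬short×long short)
  upLongLow-respects long _ _ (c1b _ short _ _) = contradiction long (¬short×long short)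
  upLongLow-respects long _ _ (c1c _ short _ _) = contradiction long (¬short×long short)
  upLongLow-respects long _ _ (c1d short) = contradiction long (¬short×long short)
  upLongLow-respects long _ _ (c1e _ short _ _) = contradiction long (¬short×long short)

  n∸k≤i : n ≤ i + k → n ∸ k ≤ i
  n∸k≤i long = subst (n ∸ k ≤_) (m+n∸n≡m i k) (∸-monoˡ-≤ k long)

  UpLongHigh : ℕ → ℕ → Set
  UpLongHigh b x = b ≤ x ⊎ (n ∸ k ≤ x × x ≤ i)

  upLongHigh-respects : n ≤ i + k → i < n → ∀ {b} → b ≤ n → UpLongHigh b Respects Cover n i k
  upLongHigh-respects long _ _ (c2a _) (inj₁ _) = inj₂ (≤-refl , n∸k≤i long)
  upLongHigh-respects _ i<n _ (c2a _) (inj₂ (_ , n≤i)) = contradiction n≤i (<⇒≱ i<n)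
  upLongHigh-respects _ _ _ (c2b _ _ _ _) (inj₁ b≤m) = inj₁ (m≤n⇒m≤1+n b≤m)
  upLongHigh-respects _ _ _ (c2b _ _ _ m<i) (inj₂ (n-k≤m , _)) = inj₂ (m≤n⇒m≤1+n n-k≤m , m<i)
  upLongHigh-respects _ _ _ (c2c _ _ _ _) (inj₁ b≤m) = inj₁ (m≤n⇒m≤1+n b≤m)
  upLongHigh-respects _ _ _ (c2c _ _ i+1≤m _) (inj₂ (_ , m≤i)) =
    contradiction m≤i (<⇒≱ (m+1≤n⇒m<n i+1≤m))
  upLongHigh-respects _ _ _ (c2d _ _ _ _) (inj₁ b≤m) = inj₁ (m≤n⇒m≤1+n b≤m)
  upLongHigh-respects _ _ _ (c2d _ _ _ m+1<n-k) (inj₂ (n-k≤m , _)) =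
    contradiction n-k≤m (<⇒≱ (<⇒≤ m+1<n-k))
  upLongHigh-respects _ _ b≤n (c2e _ _) (inj₁ _) = inj₁ b≤n
  upLongHigh-respects _ _ _ (c2e _ 1≤n-k-1) (inj₂ (n-k≤n-k-1 , _)) =
    contradiction n-k≤n-k-1 (<⇒≱ (∸-monoʳ-< z<s (≤-trans 1≤n-k-1 (m∸n≤m (n ∸ k) 1))))
  upLongHigh-respects long _ _ (c1a short) = contradiction long (¬short×long short)
  upLongHigh-respects long _ _ (c1b _ short _ _) = contradiction long (¬short×long short)
  upLongHigh-respects long _ _ (c1c _ short _ _) = contradiction long (¬short×long short)
  upLongHigh-respects long _ _ (c1d short) = contradiction long (¬short×long short)
  upLongHigh-respects long _ _ (c1e _ short _ _) = contradiction long (¬short×long short)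

  short-path : i + k + 1 ≤ n → ∀ {b} → i + 1 ≤ b → b ≤ i + k → j≤ n i k b i
  short-path short i+1≤b b≤i+k =
    ascending-path (λ {m} → c1c m short) i+1≤b b≤i+k ◅◅ c1d short ◅ ε

  long-path : n ≤ i + k → ∀ {a b} → n ∸ k ≤ a → a ≤ i → i + 1 ≤ b → b ≤ n → j≤ n i k b a
  long-path long n-k≤a a≤i i+1≤b b≤n =
    ascending-path (λ {m} → c2c m long) i+1≤b b≤n
    ◅◅ c2a long
    ◅ ascending-path (λ {m} n-k≤m m<a → c2b m long n-k≤m (<-≤-trans m<a a≤i)) ≤-refl n-k≤a

  short-descent : i + k + 1 ≤ n → ∀ {a b} → a < b → j≤ n i k b a → a ≡ i × b ≤ i + k
  short-descent short a<b b≤a =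
    [ (λ b≤a → contradiction b≤a (<⇒≱ a<b)) , id ]′
      (respects-Star (upShort-respects short _) b≤a (inj₁ ≤-refl))

  long-descent : n ≤ i + k → i < n → ∀ {a b} → b ≤ n → a < b → j≤ n i k b a →
    (n ∸ k ≤ a × a ≤ i) × i + 1 ≤ b
  long-descent long i<n {b = b} b≤n a<b b≤a with b ≤? i
  ... | yes b≤i =
    contradiction (proj₁ (respects-Star (upLongLow-respects long i<n b≤n) b≤a (≤-refl , λ _ → b≤i)))
      (<⇒≱ a<b)
  ... | no b≰i =
    [ (λ b≤a → contradiction b≤a (<⇒≱ a<b)) , (_, m<n⇒m+1≤n (≰⇒> b≰i)) ]′
      (respects-Star (upLongHigh-respects long i<n b≤n) b≤a (inj₁ ≤-refl))

  inversions-short : i + k + 1 ≤ n → 1 ≤ i → ∀ a b →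
    Inv n i k a b ⇔ (a ≡ i × i + 1 ≤ b × b ≤ i + k)
  inversions-short short 1≤i a b = mk⇔ to from
    where
    i+k≤n : i + k ≤ n
    i+k≤n = <⇒≤ (m+1≤n⇒m<n short)

    to : Inv n i k a b → a ≡ i × i + 1 ≤ b × b ≤ i + k
    to inv@(_ , _ , a<b , _) with short-descent short a<b (Inv⇒j≤ inv)
    ... | refl , b≤i+k = refl , m<n⇒m+1≤n a<b , b≤i+k

    from : a ≡ i × i + 1 ≤ b × b ≤ i + k → Inv n i k a b
    from (refl , i+1≤b , b≤i+k) =
      j≤⇒Inv (1≤i , ≤-trans (m≤m+n i k) i+k≤n) (≤-trans (m≤n+m 1 i) i+1≤b , ≤-trans b≤i+k i+k≤n)
        (m+1≤n⇒m<n i+1≤b) (short-path short i+1≤b b≤i+k)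

  inversions-long : n ≤ i + k → k < n → i < n → ∀ a b →
    Inv n i k a b ⇔ ((n ∸ k ≤ a × a ≤ i) × (i + 1 ≤ b × b ≤ n))
  inversions-long long k<n i<n a b = mk⇔ to from
    where
    to : Inv n i k a b → (n ∸ k ≤ a × a ≤ i) × (i + 1 ≤ b × b ≤ n)
    to inv@(_ , (_ , b≤n) , a<b , _) with long-descent long i<n b≤n a<b (Inv⇒j≤ inv)
    ... | a-bounds , i+1≤b = a-bounds , i+1≤b , b≤n

    from : (n ∸ k ≤ a × a ≤ i) × (i + 1 ≤ b × b ≤ n) → Inv n i k a b
    from ((n-k≤a , a≤i) , (i+1≤b , b≤n)) =
      j≤⇒Inv (≤-trans (m<n⇒0<n∸m k<n) n-k≤a , ≤-trans a≤i (<⇒≤ i<n)) (≤-trans (m≤n+m 1 i) i+1≤b , b≤n)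
        (≤-<-trans a≤i (m+1≤n⇒m<n i+1≤b)) (long-path long n-k≤a a≤i i+1≤b b≤n)

inversions-boundary : ∀ {i k} → 1 ≤ i → 1 ≤ k → ∀ a b →
  Inv (i + k) i k a b ⇔ (a ≡ i × i + 1 ≤ b × b ≤ i + k)
inversions-boundary {i} {k} 1≤i 1≤k a b =
  ⇔-trans (inversions-long ≤-refl (m<n+m k 1≤i) (m<m+n i 1≤k) a b) (mk⇔ to from)
  where
  to : (i + k ∸ k ≤ a × a ≤ i) × (i + 1 ≤ b × b ≤ i + k) → a ≡ i × i + 1 ≤ b × b ≤ i + k
  to ((i≤a , a≤i) , b-bounds) = ≤-antisym a≤i (subst (_≤ a) (m+n∸n≡m i k) i≤a) , b-bounds

  from : a ≡ i × i + 1 ≤ b × b ≤ i + k → (i + k ∸ k ≤ a × a ≤ i) × (i + 1 ≤ b × b ≤ i + k)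
  from (refl , b-bounds) = (≤-reflexive (m+n∸n≡m i k) , ≤-refl) , b-bounds

lemma9p5 : (n i k : ℕ) → 3 ≤ n → 1 ≤ i → i ≤ n ∸ 1 → 1 ≤ k → k ≤ n ∸ 1 →
    (i ≤ n ∸ k → ∀ a b → Inv n i k a b ⇔ (a ≡ i × i + 1 ≤ b × b ≤ i + k))
    × (n ∸ k < i → ∀ a b → Inv n i k a b ⇔ ((n ∸ k ≤ a × a ≤ i) × (i + 1 ≤ b × b ≤ n)))
lemma9p5 n i k 3≤n 1≤i i≤n-1 1≤k k≤n-1 = i≤n-k-case , n-k<i-case
  where
  1≤n : 1 ≤ n
  1≤n = ≤-trans (s≤s z≤n) 3≤n

  k<n : k < n
  k<n = m≤n∸1⇒m<n 1≤n k≤n-1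

  i≤n-k-case : i ≤ n ∸ k → ∀ a b → Inv n i k a b ⇔ (a ≡ i × i + 1 ≤ b × b ≤ i + k)
  i≤n-k-case i≤n-k a b with short-or-long {n} {i} {k}
  ... | inj₁ short = inversions-short short 1≤i a b
  ... | inj₂ long =
    subst (λ m → Inv m i k a b ⇔ _) (≤-antisym (m≤o∸n⇒m+n≤o i (<⇒≤ k<n) i≤n-k) long)
      (inversions-boundary 1≤i 1≤k a b)

  n-k<i-case : n ∸ k < i → ∀ a b → Inv n i k a b ⇔ ((n ∸ k ≤ a × a ≤ i) × (i + 1 ≤ b × b ≤ n))
  n-k<i-case n-k<i = inversions-long long k<n (m≤n∸1⇒m<n 1≤n i≤n-1)
    where
    long : n ≤ i + k
    long = subst (_≤ i + k) (m∸n+n≡m (<⇒≤ k<n)) (+-monoˡ-≤ k (<⇒≤ n-k<i))
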